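{- Let $k,s$ be integers with $2\le k\le s-2$, and let $G$ be a $K_s$-saturated graph on $n$ vertices with the minimum number of copies of $M_k$ (among all $n$-vertex $K_s$-saturated graphs). Then for any function $f(n)\to\infty$ as $n\to\infty$, we have $|E(G)|=O(nf(n))$.
   Context: A graph $G$ is $K_s$-saturated if $G$ contains no copy of the complete graph $K_s$, but adding any missing edge creates a copy of $K_s$. $M_k$ is a matching with $k$ edges; a copy of $M_k$ in $G$ is a subgraph of $G$ isomorphic to $M_k$. -}

module Defs where

open import Data.Nat using (ℕ; zero; suc; _<_; _<ᵇ_; _≤_)
open import Data.Fin using (Fin; toℕ; _≟_)
open import Data.Bool using (Bool; true; false; _∧_; _∨_; not)
open import Data.List using (List; []; _∷_; length; map; concatMap; allFin; filterᵇ; _++_)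
open import Data.Product using (_×_; _,_; ∃)
open import Relation.Nullary using (¬_)
open import Relation.Nullary.Decidable using (isYes)
open import Relation.Binary.PropositionalEquality using (_≡_)
open import Function.Definitions using (Injective)

record Graph (n : ℕ) : Set where
  field
    adj   : Fin n → Fin n → Bool
    sym   : ∀ x y → adj x y ≡ adj y x
    irrefl : ∀ x → adj x x ≡ false
open Graph public

Adj : ∀ {n} → Graph n → Fin n → Fin n → Set
Adj G x y = adj G x y ≡ true

edges : ∀ {n} → Graph n → List (Fin n × Fin n)
edges {n} G =
  concatMap (λ i → map (λ j → (i , j))
    (filterᵇ (λ j → (toℕ i <ᵇ toℕ j) ∧ adj G i j) (allFin n))) (allFin n)

edgeCount : ∀ {n} → Graph n → ℕ
edgeCount G = length (edges G)

-- All k-element sublists (= k-subsets, as the edge list has no repeats).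
choose : {A : Set} → ℕ → List A → List (List A)
choose zero    _        = [] ∷ []
choose (suc k) []       = []
choose (suc k) (x ∷ xs) = map (x ∷_) (choose k xs) ++ choose (suc k) xs

_≠ᵇ_ : ∀ {n} → Fin n → Fin n → Bool
a ≠ᵇ b = not (isYes (a ≟ b))

disjointᵇ : ∀ {n} → Fin n × Fin n → Fin n × Fin n → Bool
disjointᵇ (a , b) (c , d) = (a ≠ᵇ c) ∧ (a ≠ᵇ d) ∧ (b ≠ᵇ c) ∧ (b ≠ᵇ d)

allᵇ : {A : Set} → (A → Bool) → List A → Bool
allᵇ p []       = true
allᵇ p (x ∷ xs) = p x ∧ allᵇ p xs

matchingᵇ : ∀ {n} → List (Fin n × Fin n) → Bool
matchingᵇ []       = true
matchingᵇ (e ∷ es) = allᵇ (disjointᵇ e) es ∧ matchingᵇ es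

copiesMk : ∀ {n} → ℕ → Graph n → ℕ
copiesMk k G = length (filterᵇ matchingᵇ (choose k (edges G)))

HasKsAdj : ∀ {n} → ℕ → (Fin n → Fin n → Bool) → Set
HasKsAdj {n} s A = ∃ λ (φ : Fin s → Fin n) →
  Injective _≡_ _≡_ φ × (∀ a b → ¬ (a ≡ b) → A (φ a) (φ b) ≡ true)

HasKs : ∀ {n} → ℕ → Graph n → Set
HasKs s G = HasKsAdj s (adj G)

_≡ᵇ_ : ∀ {n} → Fin n → Fin n → Bool
a ≡ᵇ b = isYes (a ≟ b)

addEdgeAdj : ∀ {n} → Graph n → Fin n → Fin n → Fin n → Fin n → Bool
addEdgeAdj G x y a b = adj G a b ∨ ((a ≡ᵇ x ∧ b ≡ᵇ y) ∨ (a ≡ᵇ y ∧ b ≡ᵇ x))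

KsSaturated : ∀ {n} → ℕ → Graph n → Set
KsSaturated s G = ¬ HasKs s G ×
  (∀ x y → ¬ (x ≡ y) → adj G x y ≡ false → HasKsAdj s (addEdgeAdj G x y))

MinMkSaturated : ∀ {n} → ℕ → ℕ → Graph n → Set
MinMkSaturated {n} k s G = KsSaturated s G ×
  (∀ (H : Graph n) → KsSaturated s H → copiesMk k G ≤ copiesMk k H)

-- Write r = s - 2. The complete split graph on n vertices, whose first r vertices are joined to
-- everything and whose other vertices are pairwise non-adjacent, is K_s-saturated with at most r n
-- edges, so it has at most (r n)^k copies of M_k. On the other hand every edge of an n-vertex graph
-- meets at most 4n edges, so with t = r n + 1 a graph with at least k (t + 4n) edges has at least
-- t^k copies of M_k: by induction on k, each of its first t edges extends at least t^(k-1) copies of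
-- M_(k-1) among the later edges disjoint from it. Hence a minimiser has fewer than k (r n + 1 + 4n)
-- edges, which is at most n f(n) as soon as f(n) ≥ k (r + 5).

module Submission where

open import Defs hiding (sym)
open import Data.Bool using (Bool; true; false; _∧_; _∨_; not)
open import Data.Bool.Properties using (¬-not; ∨-comm; ∨-zeroʳ; ∧-zeroʳ; T-≡)
open import Data.Empty using (⊥-elim)
open import Data.Fin as Fin using (Fin; toℕ; _≟_)
import Data.Fin.Properties as Finₚ
open import Data.Fin.Properties using (join-splitAt; toℕ-injective; toℕ-inject≤; toℕ-fromℕ<; pigeonhole)
open import Data.List using (List; []; _∷_; length; map; filterᵇ; _++_; concat; tabulate; allFin)
open import Data.List.Properties using (length-filter; filter-++; length-++; length-map; map-tabulate; length-tabulate)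
open import Data.List.Relation.Binary.Sublist.Propositional using (_⊆_; _∷ʳ_; ⊆-refl)
open import Data.List.Relation.Binary.Sublist.Propositional.Properties using (length-mono-≤; filter⁺; filter-⊆)
open import Data.Nat
  using (ℕ; zero; suc; _∸_; NonZero; >-nonZero; _≤_; _<_; _<ᵇ_; _⊓_; _<?_; _+_; _^_; _*_; z≤n; s≤s; z<s)
open import Data.Nat.ListAction using (sum)
open import Data.Nat.Properties hiding (_≟_)
open import Data.Nat.Tactic.RingSolver using (solve-∀)
open import Data.Product using (_×_; _,_; ∃; ∃₂; proj₁; proj₂)
open import Data.Sum using (inj₁; inj₂; [_,_]′)
open import Function using (_∘_; id)
open import Function.Bundles using (Equivalence)
open import Function.Definitions using (Injective)
open import Relation.Binary.PropositionalEquality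
open import Relation.Nullary using (¬_; yes; no)
open import Relation.Nullary.Decidable using (T?; isYes; isYes≗does; dec-true; dec-false)

private
  variable
    A B : Set

countᵇ : (A → Bool) → List A → ℕ
countᵇ p xs = length (filterᵇ p xs)

countᵇ-≤-length : ∀ (p : A → Bool) xs → countᵇ p xs ≤ length xs
countᵇ-≤-length p = length-filter (T? ∘ p)

countᵇ-mono-⊆ : ∀ (p : A → Bool) {xs ys} → xs ⊆ ys → countᵇ p xs ≤ countᵇ p ys
countᵇ-mono-⊆ p xs⊆ys = length-mono-≤ (filter⁺ (T? ∘ p) (T? ∘ p) (λ { refl → id }) xs⊆ys)

countᵇ-mono : ∀ {p q : A → Bool} → (∀ x → p x ≡ true → q x ≡ true) →
  ∀ xs → countᵇ p xs ≤ countᵇ q xs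
countᵇ-mono p⇒q [] = z≤n
countᵇ-mono {p = p} {q} p⇒q (x ∷ xs) with p x in px | q x in qx
... | true  | true  = s≤s (countᵇ-mono p⇒q xs)
... | true  | false with () ← trans (sym (p⇒q x px)) qx
... | false | true  = m≤n⇒m≤1+n (countᵇ-mono p⇒q xs)
... | false | false = countᵇ-mono p⇒q xs

countᵇ-∨ : ∀ (p q : A → Bool) xs → countᵇ (λ x → p x ∨ q x) xs ≤ countᵇ p xs + countᵇ q xs
countᵇ-∨ p q [] = z≤n
countᵇ-∨ p q (x ∷ xs) with p x | q x
... | true  | true  = s≤s (≤-trans (countᵇ-∨ p q xs) (+-monoʳ-≤ (countᵇ p xs) (n≤1+n _)))
... | true  | false = s≤s (countᵇ-∨ p q xs)
... | false | true  = ≤-trans (s≤s (countᵇ-∨ p q xs)) (≤-reflexive (sym (+-suc _ _)))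
... | false | false = countᵇ-∨ p q xs

countᵇ-none : ∀ {p : A → Bool} → (∀ x → p x ≡ false) → ∀ xs → countᵇ p xs ≡ 0
countᵇ-none p≡false [] = refl
countᵇ-none p≡false (x ∷ xs) rewrite p≡false x = countᵇ-none p≡false xs

countᵇ-cong : ∀ {p q : A → Bool} → (∀ x → p x ≡ q x) → ∀ xs → countᵇ p xs ≡ countᵇ q xs
countᵇ-cong p≡q [] = refl
countᵇ-cong {p = p} {q} p≡q (x ∷ xs) with p x | q x | p≡q x
... | true  | .true  | refl = cong suc (countᵇ-cong p≡q xs)
... | false | .false | refl = countᵇ-cong p≡q xs

countᵇ-map : ∀ (p : B → Bool) (g : A → B) xs → countᵇ p (map g xs) ≡ countᵇ (p ∘ g) xs
countᵇ-map p g [] = refl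
countᵇ-map p g (x ∷ xs) with p (g x)
... | true  = cong suc (countᵇ-map p g xs)
... | false = countᵇ-map p g xs

countᵇ-++ : ∀ (p : A → Bool) xs ys → countᵇ p (xs ++ ys) ≡ countᵇ p xs + countᵇ p ys
countᵇ-++ p xs ys = trans (cong length (filter-++ (T? ∘ p) xs ys)) (length-++ (filterᵇ p xs))

countᵇ-concat : ∀ (p : A → Bool) xss → countᵇ p (concat xss) ≡ sum (map (countᵇ p) xss)
countᵇ-concat p [] = refl
countᵇ-concat p (xs ∷ xss) =
  trans (countᵇ-++ p xs (concat xss)) (cong (countᵇ p xs +_) (countᵇ-concat p xss))

length-concat : ∀ (xss : List (List A)) → length (concat xss) ≡ sum (map length xss)
length-concat [] = refl
length-concat (xs ∷ xss) = trans (length-++ xs) (cong (length xs +_) (length-concat xss))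

length≡countᵇ+countᵇ-not : ∀ (p : A → Bool) xs → length xs ≡ countᵇ p xs + countᵇ (not ∘ p) xs
length≡countᵇ+countᵇ-not p [] = refl
length≡countᵇ+countᵇ-not p (x ∷ xs) with p x
... | true  = cong suc (length≡countᵇ+countᵇ-not p xs)
... | false = trans (cong suc (length≡countᵇ+countᵇ-not p xs)) (sym (+-suc _ _))

countᵇ-choose-∷ : ∀ (q : List A → Bool) k x xs →
  countᵇ q (choose (suc k) (x ∷ xs)) ≡ countᵇ (q ∘ (x ∷_)) (choose k xs) + countᵇ q (choose (suc k) xs)
countᵇ-choose-∷ q k x xs =
  trans (countᵇ-++ q (map (x ∷_) (choose k xs)) (choose (suc k) xs))
        (cong (_+ countᵇ q (choose (suc k) xs)) (countᵇ-map q (x ∷_) (choose k xs)))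

countᵇ-choose-filterᵇ : ∀ (p : A → Bool) (q : List A → Bool) k xs →
  countᵇ (λ ys → allᵇ p ys ∧ q ys) (choose k xs) ≡ countᵇ q (choose k (filterᵇ p xs))
countᵇ-choose-filterᵇ p q zero xs with q []
... | true  = refl
... | false = refl
countᵇ-choose-filterᵇ p q (suc k) [] = refl
countᵇ-choose-filterᵇ p q (suc k) (x ∷ xs) with p x in px
... | true = begin
    countᵇ Q (choose (suc k) (x ∷ xs))
  ≡⟨ countᵇ-choose-∷ Q k x xs ⟩
    countᵇ (Q ∘ (x ∷_)) (choose k xs) + countᵇ Q (choose (suc k) xs)
  ≡⟨ cong₂ _+_ (trans (countᵇ-cong (λ ys → cong (λ b → (b ∧ allᵇ p ys) ∧ q (x ∷ ys)) px) (choose k xs))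
                      (countᵇ-choose-filterᵇ p (q ∘ (x ∷_)) k xs))
               (countᵇ-choose-filterᵇ p q (suc k) xs) ⟩
    countᵇ (q ∘ (x ∷_)) (choose k (filterᵇ p xs)) + countᵇ q (choose (suc k) (filterᵇ p xs))
  ≡⟨ countᵇ-choose-∷ q k x (filterᵇ p xs) ⟨
    countᵇ q (choose (suc k) (x ∷ filterᵇ p xs))
  ∎
  where
  open ≡-Reasoning
  Q = λ ys → allᵇ p ys ∧ q ys
... | false = begin
    countᵇ Q (choose (suc k) (x ∷ xs))
  ≡⟨ countᵇ-choose-∷ Q k x xs ⟩
    countᵇ (Q ∘ (x ∷_)) (choose k xs) + countᵇ Q (choose (suc k) xs)
  ≡⟨ cong₂ _+_ (countᵇ-none (λ ys → cong (λ b → (b ∧ allᵇ p ys) ∧ q (x ∷ ys)) px) (choose k xs))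
               (countᵇ-choose-filterᵇ p q (suc k) xs) ⟩
    countᵇ q (choose (suc k) (filterᵇ p xs))
  ∎
  where
  open ≡-Reasoning
  Q = λ ys → allᵇ p ys ∧ q ys

length-choose : ∀ k (xs : List A) → length (choose k xs) ≤ length xs ^ k
length-choose zero xs = ≤-refl
length-choose (suc k) [] = z≤n
length-choose (suc k) (x ∷ xs) = begin
    length (map (x ∷_) (choose k xs) ++ choose (suc k) xs)
  ≡⟨ length-++ (map (x ∷_) (choose k xs)) ⟩
    length (map (x ∷_) (choose k xs)) + length (choose (suc k) xs)
  ≡⟨ cong (_+ length (choose (suc k) xs)) (length-map (x ∷_) (choose k xs)) ⟩
    length (choose k xs) + length (choose (suc k) xs)
  ≤⟨ +-mono-≤ (length-choose k xs) (length-choose (suc k) xs) ⟩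
    l ^ k + l * l ^ k
  ≤⟨ +-mono-≤ (^-monoˡ-≤ k (n≤1+n l)) (*-monoʳ-≤ l (^-monoˡ-≤ k (n≤1+n l))) ⟩
    suc l ^ k + l * suc l ^ k
  ∎
  where
  open ≤-Reasoning
  l = length xs

matchings : ∀ {n} → ℕ → List (Fin n × Fin n) → ℕ
matchings k es = countᵇ matchingᵇ (choose k es)

matchings-∷ : ∀ {n} k (e : Fin n × Fin n) es →
  matchings (suc k) (e ∷ es) ≡ matchings k (filterᵇ (disjointᵇ e) es) + matchings (suc k) es
matchings-∷ k e es =
  trans (countᵇ-choose-∷ matchingᵇ k e es)
        (cong (_+ matchings (suc k) es) (countᵇ-choose-filterᵇ (disjointᵇ e) matchingᵇ k es))

BoundedConflicts : ∀ {n} → ℕ → List (Fin n × Fin n) → Set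
BoundedConflicts {n} D es = ∀ (e : Fin n × Fin n) → countᵇ (not ∘ disjointᵇ e) es ≤ D

BoundedConflicts-⊆ : ∀ {n D} {es fs : List (Fin n × Fin n)} →
  es ⊆ fs → BoundedConflicts D fs → BoundedConflicts D es
BoundedConflicts-⊆ es⊆fs bounded e = ≤-trans (countᵇ-mono-⊆ _ es⊆fs) (bounded e)

matchings-lower-bound : ∀ {n} D t k (es : List (Fin n × Fin n)) → BoundedConflicts D es →
  k * (t + D) ≤ length es → t ^ k ≤ matchings k es
matchings-lower-bound D t zero es bounded long = s≤s z≤n
matchings-lower-bound D t (suc k) es bounded long =
  greedy t es bounded (≤-trans (≤-reflexive (regroup t D k)) long)
  where
  regroup : ∀ t D k → t + (k * (t + D) + D) ≡ suc k * (t + D)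
  regroup = solve-∀
  -- each of the first a edges is the first edge of at least t ^ k of these matchings
  greedy : ∀ a es → BoundedConflicts D es → a + (k * (t + D) + D) ≤ length es →
    a * t ^ k ≤ matchings (suc k) es
  greedy zero es bounded long = z≤n
  greedy (suc a) (e ∷ es) bounded (s≤s long) =
    subst (suc a * t ^ k ≤_) (sym (matchings-∷ k e es))
      (+-mono-≤ (matchings-lower-bound D t k (filterᵇ (disjointᵇ e) es)
                   (BoundedConflicts-⊆ (filter-⊆ (T? ∘ disjointᵇ e) es) bounded′) disjoint-long)
                (greedy a es bounded′ long))
    where
    bounded′ : BoundedConflicts D es
    bounded′ = BoundedConflicts-⊆ (e ∷ʳ ⊆-refl) bounded
    disjoint-long : k * (t + D) ≤ countᵇ (disjointᵇ e) es
    disjoint-long = +-cancelʳ-≤ D _ _ (begin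
        k * (t + D) + D
      ≤⟨ m≤n+m _ a ⟩
        a + (k * (t + D) + D)
      ≤⟨ long ⟩
        length es
      ≡⟨ length≡countᵇ+countᵇ-not (disjointᵇ e) es ⟩
        countᵇ (disjointᵇ e) es + countᵇ (not ∘ disjointᵇ e) es
      ≤⟨ +-monoʳ-≤ _ (bounded′ e) ⟩
        countᵇ (disjointᵇ e) es + D
      ∎)
      where open ≤-Reasoning

sum-tabulate-zero : ∀ {n} (h : Fin n → ℕ) → (∀ i → h i ≡ 0) → sum (tabulate h) ≡ 0
sum-tabulate-zero {zero} h h≡0 = refl
sum-tabulate-zero {suc n} h h≡0 rewrite h≡0 Fin.zero = sum-tabulate-zero (h ∘ Fin.suc) (h≡0 ∘ Fin.suc)

sum-tabulate-single : ∀ {n} (h : Fin n → ℕ) v → (∀ i → i ≢ v → h i ≡ 0) → sum (tabulate h) ≡ h v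
sum-tabulate-single h Fin.zero h≡0 =
  trans (cong (h Fin.zero +_) (sum-tabulate-zero (h ∘ Fin.suc) (λ i → h≡0 (Fin.suc i) λ ())))
        (+-identityʳ (h Fin.zero))
sum-tabulate-single h (Fin.suc v) h≡0 rewrite h≡0 Fin.zero (λ ()) =
  sum-tabulate-single (h ∘ Fin.suc) v (λ i i≢v → h≡0 (Fin.suc i) (i≢v ∘ Finₚ.suc-injective))

sum-tabulate-≤ : ∀ {n} r (h : Fin n → ℕ) {B} → (∀ i → h i ≤ B) → (∀ i → r ≤ toℕ i → h i ≡ 0) →
  sum (tabulate h) ≤ r * B
sum-tabulate-≤ {zero} r h h≤B h≡0 = z≤n
sum-tabulate-≤ {suc n} zero h h≤B h≡0 = ≤-reflexive (sum-tabulate-zero h (λ i → h≡0 i z≤n))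
sum-tabulate-≤ {suc n} (suc r) h h≤B h≡0 =
  +-mono-≤ (h≤B Fin.zero)
           (sum-tabulate-≤ r (h ∘ Fin.suc) (h≤B ∘ Fin.suc) (λ i r≤i → h≡0 (Fin.suc i) (s≤s r≤i)))

countᵇ-tabulate : ∀ {n} (p : A → Bool) (g : Fin n → A) → countᵇ p (tabulate g) ≡ countᵇ (p ∘ g) (allFin n)
countᵇ-tabulate p g = trans (cong (countᵇ p) (sym (map-tabulate id g))) (countᵇ-map p g (allFin _))

countᵇ-allFin-≤1 : ∀ {n} (p : Fin n → Bool) → (∀ i j → p i ≡ true → p j ≡ true → i ≡ j) →
  countᵇ p (allFin n) ≤ 1
countᵇ-allFin-≤1 {zero} p unique = z≤n
countᵇ-allFin-≤1 {suc n} p unique with p Fin.zero in p0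
... | true  = s≤s (≤-reflexive (trans (countᵇ-tabulate p Fin.suc) (countᵇ-none p∘suc≡false (allFin n))))
  where
  p∘suc≡false : ∀ i → p (Fin.suc i) ≡ false
  p∘suc≡false i = ¬-not (Finₚ.0≢1+n ∘ unique Fin.zero (Fin.suc i) p0)
... | false = ≤-trans (≤-reflexive (countᵇ-tabulate p Fin.suc))
                (countᵇ-allFin-≤1 (p ∘ Fin.suc) (λ i j pi pj → Finₚ.suc-injective (unique _ _ pi pj)))

≡ᵇ-refl : ∀ {n} (u : Fin n) → (u ≡ᵇ u) ≡ true
≡ᵇ-refl u = trans (isYes≗does (u ≟ u)) (dec-true (u ≟ u) refl)

≢⇒≡ᵇ-false : ∀ {n} {u v : Fin n} → u ≢ v → (u ≡ᵇ v) ≡ false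
≢⇒≡ᵇ-false {u = u} {v} u≢v = trans (isYes≗does (u ≟ v)) (dec-false (u ≟ v) u≢v)

≡ᵇ-true⇒≡ : ∀ {n} (u v : Fin n) → (u ≡ᵇ v) ≡ true → u ≡ v
≡ᵇ-true⇒≡ u v u≡ᵇv with u ≟ v
... | yes u≡v = u≡v
... | no u≢v with () ← u≡ᵇv

≡ᵇ-sym : ∀ {n} (u v : Fin n) → (u ≡ᵇ v) ≡ (v ≡ᵇ u)
≡ᵇ-sym u v with u ≟ v
... | yes refl = sym (≡ᵇ-refl u)
... | no u≢v = sym (≢⇒≡ᵇ-false (u≢v ∘ sym))

<⇒<ᵇ≡true : ∀ {m n} → m < n → (m <ᵇ n) ≡ true
<⇒<ᵇ≡true m<n = Equivalence.to T-≡ (<⇒<ᵇ m<n)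

≤⇒<ᵇ≡false : ∀ {m n} → n ≤ m → (m <ᵇ n) ≡ false
≤⇒<ᵇ≡false {m} {n} n≤m = ¬-not (λ m<ᵇn → <⇒≱ (<ᵇ⇒< m n (Equivalence.from T-≡ m<ᵇn)) n≤m)

upperNeighbours : ∀ {n} → Graph n → Fin n → List (Fin n)
upperNeighbours {n} G i = filterᵇ (λ j → (toℕ i <ᵇ toℕ j) ∧ adj G i j) (allFin n)

row : ∀ {n} → Graph n → Fin n → List (Fin n × Fin n)
row G i = map (i ,_) (upperNeighbours G i)

fstIsᵇ sndIsᵇ incidentᵇ : ∀ {n} → Fin n → Fin n × Fin n → Bool
fstIsᵇ v (c , d) = v ≡ᵇ c
sndIsᵇ v (c , d) = v ≡ᵇ d
incidentᵇ v e = fstIsᵇ v e ∨ sndIsᵇ v e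

not-disjoint⇒incident : ∀ {n} (a b : Fin n) e → not (disjointᵇ (a , b) e) ≡ true →
  (incidentᵇ a e ∨ incidentᵇ b e) ≡ true
not-disjoint⇒incident a b (c , d) meets with isYes (a ≟ c) | isYes (a ≟ d) | isYes (b ≟ c) | isYes (b ≟ d)
... | true  | _     | _     | _     = refl
... | false | true  | _     | _     = refl
... | false | false | true  | _     = refl
... | false | false | false | true  = refl
... | false | false | false | false with () ← meets

module _ {n : ℕ} (G : Graph n) where

  length-row≤ : ∀ i → length (row G i) ≤ n
  length-row≤ i = begin
      length (row G i)
    ≡⟨ length-map (i ,_) (upperNeighbours G i) ⟩
      length (upperNeighbours G i)
    ≤⟨ countᵇ-≤-length _ (allFin n) ⟩
      length (allFin n)
    ≡⟨ length-tabulate id ⟩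
      n
    ∎
    where open ≤-Reasoning

  map-rows : ∀ (h : List (Fin n × Fin n) → ℕ) → map h (map (row G) (allFin n)) ≡ tabulate (h ∘ row G)
  map-rows h = trans (cong (map h) (map-tabulate id (row G))) (map-tabulate (row G) h)

  edgeCount-rows : edgeCount G ≡ sum (tabulate (length ∘ row G))
  edgeCount-rows = trans (length-concat (map (row G) (allFin n))) (cong sum (map-rows length))

  countᵇ-edges : ∀ p → countᵇ p (edges G) ≡ sum (tabulate (countᵇ p ∘ row G))
  countᵇ-edges p = trans (countᵇ-concat p (map (row G) (allFin n))) (cong sum (map-rows (countᵇ p)))

  countᵇ-fstIs-edges : ∀ v → countᵇ (fstIsᵇ v) (edges G) ≤ n
  countᵇ-fstIs-edges v = begin
      countᵇ (fstIsᵇ v) (edges G)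
    ≡⟨ countᵇ-edges (fstIsᵇ v) ⟩
      sum (tabulate (countᵇ (fstIsᵇ v) ∘ row G))
    ≡⟨ sum-tabulate-single _ v other-rows ⟩
      countᵇ (fstIsᵇ v) (row G v)
    ≤⟨ countᵇ-≤-length _ (row G v) ⟩
      length (row G v)
    ≤⟨ length-row≤ v ⟩
      n
    ∎
    where
    open ≤-Reasoning
    other-rows : ∀ i → i ≢ v → countᵇ (fstIsᵇ v) (row G i) ≡ 0
    other-rows i i≢v =
      trans (countᵇ-map (fstIsᵇ v) (i ,_) (upperNeighbours G i))
            (countᵇ-none (λ _ → ≢⇒≡ᵇ-false (i≢v ∘ sym)) (upperNeighbours G i))

  countᵇ-sndIs-edges : ∀ v → countᵇ (sndIsᵇ v) (edges G) ≤ n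
  countᵇ-sndIs-edges v = begin
      countᵇ (sndIsᵇ v) (edges G)
    ≡⟨ countᵇ-edges (sndIsᵇ v) ⟩
      sum (tabulate (countᵇ (sndIsᵇ v) ∘ row G))
    ≤⟨ sum-tabulate-≤ n _ row≤1 (λ i n≤i → ⊥-elim (<⇒≱ (Finₚ.toℕ<n i) n≤i)) ⟩
      n * 1
    ≡⟨ *-identityʳ n ⟩
      n
    ∎
    where
    open ≤-Reasoning
    row≤1 : ∀ i → countᵇ (sndIsᵇ v) (row G i) ≤ 1
    row≤1 i = begin
        countᵇ (sndIsᵇ v) (row G i)
      ≡⟨ countᵇ-map (sndIsᵇ v) (i ,_) (upperNeighbours G i) ⟩
        countᵇ (v ≡ᵇ_) (upperNeighbours G i)
      ≤⟨ countᵇ-mono-⊆ (v ≡ᵇ_) (filter-⊆ _ (allFin n)) ⟩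
        countᵇ (v ≡ᵇ_) (allFin n)
      ≤⟨ countᵇ-allFin-≤1 (v ≡ᵇ_) (λ i j v≡ᵇi v≡ᵇj →
           trans (sym (≡ᵇ-true⇒≡ v i v≡ᵇi)) (≡ᵇ-true⇒≡ v j v≡ᵇj)) ⟩
        1
      ∎

  countᵇ-incident-edges : ∀ v → countᵇ (incidentᵇ v) (edges G) ≤ 2 * n
  countᵇ-incident-edges v = begin
      countᵇ (incidentᵇ v) (edges G)
    ≤⟨ countᵇ-∨ (fstIsᵇ v) (sndIsᵇ v) (edges G) ⟩
      countᵇ (fstIsᵇ v) (edges G) + countᵇ (sndIsᵇ v) (edges G)
    ≤⟨ +-mono-≤ (countᵇ-fstIs-edges v) (countᵇ-sndIs-edges v) ⟩
      n + n
    ≡⟨ cong (n +_) (+-identityʳ n) ⟨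
      2 * n
    ∎
    where open ≤-Reasoning

  edges-boundedConflicts : BoundedConflicts (4 * n) (edges G)
  edges-boundedConflicts (a , b) = begin
      countᵇ (not ∘ disjointᵇ (a , b)) (edges G)
    ≤⟨ countᵇ-mono (not-disjoint⇒incident a b) (edges G) ⟩
      countᵇ (λ e → incidentᵇ a e ∨ incidentᵇ b e) (edges G)
    ≤⟨ countᵇ-∨ (incidentᵇ a) (incidentᵇ b) (edges G) ⟩
      countᵇ (incidentᵇ a) (edges G) + countᵇ (incidentᵇ b) (edges G)
    ≤⟨ +-mono-≤ (countᵇ-incident-edges a) (countᵇ-incident-edges b) ⟩
      2 * n + 2 * n
    ≡⟨ *-distribʳ-+ n 2 2 ⟨
      4 * n
    ∎
    where open ≤-Reasoning

IsClique : ∀ {n s} → (Fin n → Fin n → Bool) → (Fin s → Fin n) → Set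
IsClique A φ = Injective _≡_ _≡_ φ × (∀ a b → a ≢ b → A (φ a) (φ b) ≡ true)

IsClique-mono : ∀ {n s} {A B : Fin n → Fin n → Bool} {φ : Fin s → Fin n} →
  (∀ u v → A u v ≡ true → B u v ≡ true) → IsClique A φ → IsClique B φ
IsClique-mono A⇒B (φ-injective , φ-adjacent) = φ-injective , λ a b a≢b → A⇒B _ _ (φ-adjacent a b a≢b)

pair : ∀ {n} → Fin n → Fin n → Fin 2 → Fin n
pair u v Fin.zero = u
pair u v (Fin.suc Fin.zero) = v

pair-isClique : ∀ {n} (A : Fin n → Fin n → Bool) {u v : Fin n} → u ≢ v → A u v ≡ true → A v u ≡ true →
  IsClique A (pair u v)
pair-isClique A {u} {v} u≢v uv vu = injective , adjacent
  where
  injective : Injective _≡_ _≡_ (pair u v)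
  injective {Fin.zero} {Fin.zero} _ = refl
  injective {Fin.zero} {Fin.suc Fin.zero} u≡v = ⊥-elim (u≢v u≡v)
  injective {Fin.suc Fin.zero} {Fin.zero} v≡u = ⊥-elim (u≢v (sym v≡u))
  injective {Fin.suc Fin.zero} {Fin.suc Fin.zero} _ = refl
  adjacent : ∀ a b → a ≢ b → _
  adjacent Fin.zero Fin.zero a≢b = ⊥-elim (a≢b refl)
  adjacent Fin.zero (Fin.suc Fin.zero) _ = uv
  adjacent (Fin.suc Fin.zero) Fin.zero _ = vu
  adjacent (Fin.suc Fin.zero) (Fin.suc Fin.zero) a≢b = ⊥-elim (a≢b refl)

IsClique-join : ∀ {n a b} {A : Fin n → Fin n → Bool} {φ : Fin a → Fin n} {ψ : Fin b → Fin n} →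
  IsClique A φ → IsClique A ψ →
  (∀ i j → A (φ i) (ψ j) ≡ true) → (∀ i j → A (ψ j) (φ i) ≡ true) → (∀ i j → φ i ≢ ψ j) →
  IsClique A ([ φ , ψ ]′ ∘ Fin.splitAt a)
IsClique-join {a = a} {b} {A} {φ} {ψ} (φ-injective , φ-adjacent) (ψ-injective , ψ-adjacent) φψ ψφ φ≢ψ =
  (λ e → splitAt-injective (χ-injective _ _ e)) ,
  (λ x y x≢y → χ-adjacent _ _ (x≢y ∘ splitAt-injective))
  where
  χ = [ φ , ψ ]′
  splitAt-injective : ∀ {x y} → Fin.splitAt a {b} x ≡ Fin.splitAt a y → x ≡ y
  splitAt-injective {x} {y} e =
    trans (sym (join-splitAt a b x)) (trans (cong (Fin.join a b) e) (join-splitAt a b y))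
  χ-injective : ∀ x y → χ x ≡ χ y → x ≡ y
  χ-injective (inj₁ i) (inj₁ j) e = cong inj₁ (φ-injective e)
  χ-injective (inj₁ i) (inj₂ j) e = ⊥-elim (φ≢ψ i j e)
  χ-injective (inj₂ j) (inj₁ i) e = ⊥-elim (φ≢ψ i j (sym e))
  χ-injective (inj₂ i) (inj₂ j) e = cong inj₂ (ψ-injective e)
  χ-adjacent : ∀ x y → x ≢ y → A (χ x) (χ y) ≡ true
  χ-adjacent (inj₁ i) (inj₁ j) x≢y = φ-adjacent i j (x≢y ∘ cong inj₁)
  χ-adjacent (inj₁ i) (inj₂ j) _ = φψ i j
  χ-adjacent (inj₂ j) (inj₁ i) _ = ψφ i j
  χ-adjacent (inj₂ i) (inj₂ j) x≢y = ψ-adjacent i j (x≢y ∘ cong inj₂)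

addEdgeAdj-⊇ : ∀ {n} (G : Graph n) x y u v → adj G u v ≡ true → addEdgeAdj G x y u v ≡ true
addEdgeAdj-⊇ G x y u v uv = cong (_∨ _) uv

addEdgeAdj-new : ∀ {n} (G : Graph n) x y → addEdgeAdj G x y x y ≡ true
addEdgeAdj-new G x y rewrite ≡ᵇ-refl x | ≡ᵇ-refl y = ∨-zeroʳ _

addEdgeAdj-new′ : ∀ {n} (G : Graph n) x y → addEdgeAdj G x y y x ≡ true
addEdgeAdj-new′ G x y rewrite ≡ᵇ-refl x | ≡ᵇ-refl y = trans (cong (adj G y x ∨_) (∨-zeroʳ _)) (∨-zeroʳ _)

completeSplit : ℕ → ∀ n → Graph n
completeSplit r n = record
  { adj    = λ a b → (a ≠ᵇ b) ∧ ((toℕ a <ᵇ r) ∨ (toℕ b <ᵇ r))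
  ; sym    = λ a b → cong₂ _∧_ (cong not (≡ᵇ-sym a b)) (∨-comm (toℕ a <ᵇ r) (toℕ b <ᵇ r))
  ; irrefl = λ a → cong (λ e → not e ∧ ((toℕ a <ᵇ r) ∨ (toℕ a <ᵇ r))) (≡ᵇ-refl a)
  }

module _ (r n : ℕ) where

  private
    H = completeSplit r n

  completeSplit-adjˡ : ∀ a b → a ≢ b → toℕ a < r → adj H a b ≡ true
  completeSplit-adjˡ a b a≢b a<r =
    cong₂ _∧_ (cong not (≢⇒≡ᵇ-false a≢b)) (cong (_∨ (toℕ b <ᵇ r)) (<⇒<ᵇ≡true a<r))

  completeSplit-adjʳ : ∀ a b → a ≢ b → toℕ b < r → adj H a b ≡ true
  completeSplit-adjʳ a b a≢b b<r = trans (Graph.sym H a b) (completeSplit-adjˡ b a (a≢b ∘ sym) b<r)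

  completeSplit-nonadj : ∀ a b → r ≤ toℕ a → r ≤ toℕ b → adj H a b ≡ false
  completeSplit-nonadj a b r≤a r≤b =
    trans (cong₂ (λ u v → (a ≠ᵇ b) ∧ (u ∨ v)) (≤⇒<ᵇ≡false r≤a) (≤⇒<ᵇ≡false r≤b)) (∧-zeroʳ _)

  completeSplit-edgeCount≤ : edgeCount H ≤ r * n
  completeSplit-edgeCount≤ = begin
      edgeCount H
    ≡⟨ edgeCount-rows H ⟩
      sum (tabulate (length ∘ row H))
    ≤⟨ sum-tabulate-≤ r (length ∘ row H) (length-row≤ H) noncore-row ⟩
      r * n
    ∎
    where
    open ≤-Reasoning
    noncore-row : ∀ i → r ≤ toℕ i → length (row H i) ≡ 0
    noncore-row i r≤i = trans (length-map (i ,_) (upperNeighbours H i)) (countᵇ-none later-nonadj (allFin n))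
      where
      later-nonadj : ∀ j → ((toℕ i <ᵇ toℕ j) ∧ adj H i j) ≡ false
      later-nonadj j with toℕ i <ᵇ toℕ j in i<ᵇj
      ... | false = refl
      ... | true  = completeSplit-nonadj i j r≤i
                      (≤-trans r≤i (<⇒≤ (<ᵇ⇒< (toℕ i) (toℕ j) (Equivalence.from T-≡ i<ᵇj))))

  -- Distinct vertices with the same clamp value are non-core, hence non-adjacent: this is why a
  -- clique of H has at most r + 1 vertices.
  clamp : Fin n → Fin (suc r)
  clamp x = Fin.fromℕ< (s≤s (m⊓n≤n (toℕ x) r))

  ⊓-injective-on-edges : ∀ x y → adj H x y ≡ true → toℕ x ⊓ r ≡ toℕ y ⊓ r → x ≡ y
  ⊓-injective-on-edges x y xy x⊓r≡y⊓r with toℕ x <? r | toℕ y <? r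
  ... | yes x<r | yes y<r =
    toℕ-injective (trans (sym (m≤n⇒m⊓n≡m (<⇒≤ x<r))) (trans x⊓r≡y⊓r (m≤n⇒m⊓n≡m (<⇒≤ y<r))))
  ... | yes x<r | no y≮r =
    ⊥-elim (<-irrefl (trans (sym (m≤n⇒m⊓n≡m (<⇒≤ x<r)))
                             (trans x⊓r≡y⊓r (m≥n⇒m⊓n≡n (≮⇒≥ y≮r)))) x<r)
  ... | no x≮r  | yes y<r =
    ⊥-elim (<-irrefl (trans (sym (m≤n⇒m⊓n≡m (<⇒≤ y<r)))
                             (trans (sym x⊓r≡y⊓r) (m≥n⇒m⊓n≡n (≮⇒≥ x≮r)))) y<r)
  ... | no x≮r  | no y≮r with () ← trans (sym xy) (completeSplit-nonadj x y (≮⇒≥ x≮r) (≮⇒≥ y≮r))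

  completeSplit-Ks-free : ∀ s → suc r < s → ¬ HasKs s H
  completeSplit-Ks-free s r<s (φ , φ-injective , φ-adjacent)
    with i , j , i<j , ci≡cj ← pigeonhole r<s (clamp ∘ φ) =
    Finₚ.<⇒≢ i<j (φ-injective (⊓-injective-on-edges (φ i) (φ j) (φ-adjacent i j (Finₚ.<⇒≢ i<j))
      (trans (sym (toℕ-fromℕ< _)) (trans (cong toℕ ci≡cj) (toℕ-fromℕ< _)))))

  completeSplit-saturated : KsSaturated (r + 2) H
  completeSplit-saturated = completeSplit-Ks-free (r + 2) (≤-reflexive (sym (+-comm r 2))) , saturate
    where
    noncore-endpoint : ∀ x y → x ≢ y → adj H x y ≡ false → r ≤ toℕ x
    noncore-endpoint x y x≢y nonadj with toℕ x <? r
    ... | yes x<r with () ← trans (sym (completeSplit-adjˡ x y x≢y x<r)) nonadj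
    ... | no x≮r  = ≮⇒≥ x≮r
    saturate : ∀ x y → x ≢ y → adj H x y ≡ false → HasKsAdj (r + 2) (addEdgeAdj H x y)
    saturate x y x≢y nonadj = [ core , pair x y ]′ ∘ Fin.splitAt r ,
      IsClique-join {A = addEdgeAdj H x y}
        (IsClique-mono (addEdgeAdj-⊇ H x y) core-isClique)
        (pair-isClique (addEdgeAdj H x y) x≢y (addEdgeAdj-new H x y) (addEdgeAdj-new′ H x y))
        (λ i j → addEdgeAdj-⊇ H x y _ _ (completeSplit-adjˡ _ _ (core≢pair i j) (core<r i)))
        (λ i j → addEdgeAdj-⊇ H x y _ _ (completeSplit-adjʳ _ _ (core≢pair i j ∘ sym) (core<r i)))
        core≢pair
      where
      r≤x : r ≤ toℕ x
      r≤x = noncore-endpoint x y x≢y nonadj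
      r≤y : r ≤ toℕ y
      r≤y = noncore-endpoint y x (x≢y ∘ sym) (trans (Graph.sym H y x) nonadj)
      core : Fin r → Fin n
      core i = Fin.inject≤ i (≤-trans r≤x (<⇒≤ (Finₚ.toℕ<n x)))
      core<r : ∀ i → toℕ (core i) < r
      core<r i = subst (_< r) (sym (toℕ-inject≤ i _)) (Finₚ.toℕ<n i)
      core-isClique : IsClique (adj H) core
      core-isClique = (λ {i} {j} → Finₚ.inject≤-injective _ _ i j) ,
        (λ i j i≢j → completeSplit-adjˡ _ _ (i≢j ∘ Finₚ.inject≤-injective _ _ i j) (core<r i))
      pair-noncore : ∀ j → r ≤ toℕ (pair x y j)
      pair-noncore Fin.zero = r≤x
      pair-noncore (Fin.suc Fin.zero) = r≤y
      core≢pair : ∀ i j → core i ≢ pair x y j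
      core≢pair i j e = <⇒≱ (core<r i) (subst (λ v → r ≤ toℕ v) (sym e) (pair-noncore j))

matchings≤ : ∀ {n} k (es : List (Fin n × Fin n)) → matchings k es ≤ length es ^ k
matchings≤ k es = ≤-trans (countᵇ-≤-length matchingᵇ (choose k es)) (length-choose k es)

MinMkSaturated⇒edgeCount< : ∀ {n} k r .{{_ : NonZero k}} (G : Graph n) → MinMkSaturated k (r + 2) G →
  edgeCount G < k * (suc (r * n) + 4 * n)
MinMkSaturated⇒edgeCount< {n} k r G (_ , minimal) = ≰⇒> λ many-edges → <-irrefl refl (begin-strict
    (r * n) ^ k
  <⟨ ^-monoˡ-< k (n<1+n (r * n)) ⟩
    suc (r * n) ^ k
  ≤⟨ matchings-lower-bound (4 * n) (suc (r * n)) k (edges G) (edges-boundedConflicts G) many-edges ⟩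
    copiesMk k G
  ≤⟨ minimal H (completeSplit-saturated r n) ⟩
    copiesMk k H
  ≤⟨ matchings≤ k (edges H) ⟩
    edgeCount H ^ k
  ≤⟨ ^-monoˡ-≤ k (completeSplit-edgeCount≤ r n) ⟩
    (r * n) ^ k
  ∎)
  where
  open ≤-Reasoning
  H = completeSplit r n

lemma2p3 : ∀ (k s : ℕ) → 2 ≤ k → k + 2 ≤ s →
    ∀ (f : ℕ → ℕ) → (∀ M → ∃ λ N → ∀ n → N ≤ n → M ≤ f n) →
    ∃₂ λ C N → ∀ n → N ≤ n → ∀ (G : Graph n) →
      MinMkSaturated k s G → edgeCount G ≤ C * n * f n
lemma2p3 k s 2≤k k+2≤s f f→∞ = 1 , suc N , bound
  where
  r = s ∸ 2
  s≡r+2 : s ≡ r + 2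
  s≡r+2 = sym (m∸n+n≡m (≤-trans (m≤n+m 2 k) k+2≤s))
  instance
    k≢0 : NonZero k
    k≢0 = >-nonZero (<-≤-trans z<s 2≤k)
  N = proj₁ (f→∞ (k * (r + 5)))
  regroup : ∀ k r m → suc m * (k * (r + 5)) ≡ k * (suc (r * suc m) + 4 * suc m) + k * m
  regroup = solve-∀
  bound : ∀ n → suc N ≤ n → ∀ (G : Graph n) → MinMkSaturated k s G → edgeCount G ≤ 1 * n * f n
  bound (suc m) (s≤s N≤m) G minimal = begin
      edgeCount G
    <⟨ MinMkSaturated⇒edgeCount< k r G (subst (λ s → MinMkSaturated k s G) s≡r+2 minimal) ⟩
      k * (suc (r * suc m) + 4 * suc m)
    ≤⟨ m≤m+n _ (k * m) ⟩
      k * (suc (r * suc m) + 4 * suc m) + k * m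
    ≡⟨ regroup k r m ⟨
      suc m * (k * (r + 5))
    ≤⟨ *-monoʳ-≤ (suc m) (proj₂ (f→∞ (k * (r + 5))) (suc m) (m≤n⇒m≤1+n N≤m)) ⟩
      suc m * f (suc m)
    ≡⟨ cong (_* f (suc m)) (*-identityˡ (suc m)) ⟨
      1 * suc m * f (suc m)
    ∎
    where open ≤-Reasoning
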